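{- Let $G$ be a connected quasi-threshold graph and let $T$ be a tree representation of $G$ with root $r$. Let $P=\langle r=v_1,v_2,\ldots,v_p\rangle$ be a maximal directed path in $T$ starting at the root (so $v_p$ is a leaf and $v_{j+1}$ is a child of $v_j$). Then (1) the set $\{v_1,\ldots,v_p\}$ is a maximal clique $Q$ of $G$; and (2) there exists $k\ge 2$ such that $v_k,v_{k+1},\ldots,v_p$ are simplicial vertices of $G$ belonging to $Q$.
   Context: All graphs are finite, simple and undirected. Quasi-threshold graphs are defined recursively: (i) a single isolated vertex is a quasi-threshold graph; (ii) adding to a quasi-threshold graph a new vertex adjacent to all of its vertices gives a quasi-threshold graph; (iii) the disjoint union of two quasi-threshold graphs is a quasi-threshold graph. A connected graph $G$ is quasi-threshold iff it is the comparability graph of a rooted tree; a tree representation of a connected quasi-threshold graph $G=(V,E)$ is a rooted tree $T$ on vertex set $V$ (edges directed from parent to child) such that two distinct vertices are adjacent in $G$ if and only if one of them is an ancestor of the other in $T$. A clique is a set of pairwise adjacent vertices; a vertex $v$ is simplicial if its neighbourhood is a clique. -}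

module Defs where

open import Data.Nat using (ℕ; suc)
open import Data.Fin using (Fin; zero; suc; inject₁; fromℕ)
open import Data.Maybe using (Maybe; just; nothing)
open import Data.Product using (Σ; ∃; _×_; _,_)
open import Data.Sum using (_⊎_)
open import Relation.Nullary using (¬_)
open import Relation.Binary.PropositionalEquality using (_≡_; _≢_)

record Graph (n : ℕ) : Set₁ where
  field
    Adj   : Fin n → Fin n → Set
    sym   : ∀ {u v} → Adj u v → Adj v u
    irrefl : ∀ {u} → ¬ Adj u u

open Graph public

-- A rooted forest on Fin n given by a parent function.
-- Anc p u v : u is a proper ancestor of v.
data Anc {n : ℕ} (parent : Fin n → Maybe (Fin n)) (u : Fin n) : Fin n → Set where
  par  : ∀ {v} → parent v ≡ just u → Anc parent u v
  step : ∀ {w v} → Anc parent u w → parent v ≡ just w → Anc parent u v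

-- A rooted tree on Fin n with root r: r has no parent and r is an ancestor
-- of every other vertex (so every parent chain ends at r: connected, acyclic).
record RootedTree (n : ℕ) (r : Fin n) : Set where
  field
    parent     : Fin n → Maybe (Fin n)
    root-noPar : parent r ≡ nothing
    root-anc   : ∀ v → v ≢ r → Anc parent r v

open RootedTree public

Ancestor : ∀ {n r} → RootedTree n r → Fin n → Fin n → Set
Ancestor T = Anc (parent T)

IsTreeRep : ∀ {n r} → Graph n → RootedTree n r → Set
IsTreeRep G T = ∀ u v → u ≢ v →
  (Adj G u v → Ancestor T u v ⊎ Ancestor T v u) ×
  (Ancestor T u v ⊎ Ancestor T v u → Adj G u v)

IsClique : ∀ {n} → Graph n → (Fin n → Set) → Set
IsClique G S = ∀ u v → S u → S v → u ≢ v → Adj G u v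

IsMaximalClique : ∀ {n} → Graph n → (Fin n → Set) → Set
IsMaximalClique G S =
  IsClique G S × (∀ w → IsClique G (λ x → S x ⊎ x ≡ w) → S w)

Simplicial : ∀ {n} → Graph n → Fin n → Set
Simplicial G v = IsClique G (Adj G v)

-- A maximal directed path from the root, of length p = suc m:
-- v 0 = r, v (i+1) is a child of v i, and the last vertex is a leaf.
IsRootLeafPath : ∀ {n r} (T : RootedTree n r) (m : ℕ) → (Fin (suc m) → Fin n) → Set
IsRootLeafPath {r = r} T m v =
  (v zero ≡ r) ×
  (∀ (i : Fin m) → parent T (v (suc i)) ≡ just (v (inject₁ i))) ×
  (∀ w → parent T w ≢ just (v (fromℕ m)))

PathSet : ∀ {n m} → (Fin (suc m) → Fin n) → Fin n → Set
PathSet v x = ∃ λ i → v i ≡ x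

-- Every vertex of the path is an ancestor of (or equal to) the leaf ℓ at its end, and conversely
-- every ancestor of ℓ lies on the path, since the parent chain of ℓ runs back to the root along it.
-- In a tree representation the ancestors of a vertex are pairwise comparable, hence pairwise
-- adjacent; and a neighbour of the childless ℓ must be an ancestor of ℓ. So the path is the
-- clique of ancestors of ℓ, it is maximal, and N(ℓ) lies inside it, making ℓ simplicial.
module Submission where

open import Defs hiding (sym)
open import Level using (0ℓ)
open import Data.Nat using (ℕ; suc; _≤_; _⊔_; zero; s≤s; s≤s⁻¹)
open import Data.Nat.Properties using (m≤m⊔n; m≤n⊔m; ≤-refl; ≤-trans)
open import Data.Fin using (Fin; toℕ; zero; suc; inject₁; fromℕ; _≟_)
open import Data.Product using (∃; _×_; _,_; proj₁; proj₂)
open import Data.Sum using (_⊎_; inj₁; inj₂)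
open import Data.Maybe using (Maybe; just; nothing)
open import Data.Maybe.Properties using (just-injective)
open import Relation.Nullary using (¬_; yes; no; contradiction)
open import Relation.Unary using (Pred; _⊆_)
open import Relation.Binary.Core using (Rel)
open import Relation.Binary.Definitions using (Reflexive; Transitive)
open import Relation.Binary.Construct.Closure.Reflexive using (ReflClosure; refl; [_])
open import Relation.Binary.PropositionalEquality
  using (_≡_; _≢_; refl; sym; trans; subst; cong)

chain-reaches-last : ∀ {a ℓ} {A : Set a} {R : Rel A ℓ} → Reflexive R → Transitive R →
  ∀ {m} (f : Fin (suc m) → A) → (∀ i → R (f (inject₁ i)) (f (suc i))) →
  ∀ i → R (f i) (f (fromℕ m))
chain-reaches-last R-refl R-trans {zero}  f steps zero    = R-refl
chain-reaches-last {R = R} R-refl R-trans {suc m} f steps zero    =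
  R-trans (steps zero)
    (chain-reaches-last {R = R} R-refl R-trans (λ j → f (suc j)) (λ j → steps (suc j)) zero)
chain-reaches-last {R = R} R-refl R-trans {suc m} f steps (suc i) =
  chain-reaches-last {R = R} R-refl R-trans (λ j → f (suc j)) (λ j → steps (suc j)) i

last-index : ∀ {m} (i : Fin (suc m)) → m ≤ toℕ i → i ≡ fromℕ m
last-index {zero}  zero    _         = refl
last-index {suc m} zero    ()
last-index {suc m} (suc i) (s≤s m≤i) = cong suc (last-index i m≤i)

IsMaximalClique-resp : ∀ {n} (G : Graph n) {S S′ : Pred (Fin n) 0ℓ} → S ⊆ S′ → S′ ⊆ S →
  IsMaximalClique G S′ → IsMaximalClique G S
IsMaximalClique-resp G {S} {S′} S⊆S′ S′⊆S (clique , maximal) =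
  (λ u v Su Sv → clique u v (S⊆S′ Su) (S⊆S′ Sv)) ,
  (λ w clique+w → S′⊆S (maximal w (λ u v u∈ v∈ → clique+w u v (into u∈) (into v∈))))
  where
  into : ∀ {w x} → S′ x ⊎ x ≡ w → S x ⊎ x ≡ w
  into (inj₁ S′x) = inj₁ (S′⊆S S′x)
  into (inj₂ x≡w) = inj₂ x≡w

module Ancestry {n : ℕ} (P : Fin n → Maybe (Fin n)) where

  _≼_ : Rel (Fin n) 0ℓ
  _≼_ = ReflClosure (Anc P)

  Anc-trans : Transitive (Anc P)
  Anc-trans a<b (par b-par)      = step a<b b-par
  Anc-trans a<b (step b<w c-par) = step (Anc-trans a<b b<w) c-par

  ≼-trans : Transitive _≼_
  ≼-trans refl    b≼c     = b≼c
  ≼-trans [ a<b ] refl    = [ a<b ]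
  ≼-trans [ a<b ] [ b<c ] = [ Anc-trans a<b b<c ]

  -- A vertex has a unique parent, so the ancestors of x form a chain.
  Anc-comparable : ∀ {a b x} → Anc P a x → Anc P b x → a ≢ b → Anc P a b ⊎ Anc P b a
  Anc-comparable (par p) (par q) a≢b = contradiction (just-injective (trans (sym p) q)) a≢b
  Anc-comparable (par p) (step b<w q) _ rewrite just-injective (trans (sym p) q) = inj₂ b<w
  Anc-comparable (step a<w p) (par q) _ rewrite just-injective (trans (sym q) p) = inj₁ a<w
  Anc-comparable (step a<w p) (step b<w q) a≢b with just-injective (trans (sym p) q)
  ... | refl = Anc-comparable a<w b<w a≢b

  ≼-comparable : ∀ {a b x} → a ≼ x → b ≼ x → a ≢ b → Anc P a b ⊎ Anc P b a
  ≼-comparable refl    refl    a≢b = contradiction refl a≢b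
  ≼-comparable refl    [ b<a ] _   = inj₂ b<a
  ≼-comparable [ a<b ] refl    _   = inj₁ a<b
  ≼-comparable [ a<x ] [ b<x ] a≢b = Anc-comparable a<x b<x a≢b

  parentless⇒¬Anc : ∀ {a r} → P r ≡ nothing → ¬ Anc P a r
  parentless⇒¬Anc r-root (par p)    with trans (sym r-root) p
  ... | ()
  parentless⇒¬Anc r-root (step _ p) with trans (sym r-root) p
  ... | ()

  Childless : Fin n → Set
  Childless l = ∀ w → P w ≢ just l

  childless⇒¬Anc : ∀ {l x} → Childless l → ¬ Anc P l x
  childless⇒¬Anc no-child (par p)      = no-child _ p
  childless⇒¬Anc no-child (step l<w _) = childless⇒¬Anc no-child l<w

module TreeRepresentation {n : ℕ} (G : Graph n) {r : Fin n} (T : RootedTree n r)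
                          (rep : IsTreeRep G T) where

  open Ancestry (parent T)

  lineage-clique : ∀ x → IsClique G (_≼ x)
  lineage-clique x a b a≼x b≼x a≢b = proj₂ (rep a b a≢b) (≼-comparable a≼x b≼x a≢b)

  neighbour-of-childless : ∀ {l a} → Childless l → Adj G l a → Anc (parent T) a l
  neighbour-of-childless {l} {a} no-child l~a
    with proj₁ (rep l a (λ l≡a → irrefl G (subst (Adj G l) (sym l≡a) l~a))) l~a
  ... | inj₁ l<a = contradiction l<a (childless⇒¬Anc no-child)
  ... | inj₂ a<l = a<l

  childless-simplicial : ∀ {l} → Childless l → Simplicial G l
  childless-simplicial no-child a b l~a l~b =
    lineage-clique _ a b [ neighbour-of-childless no-child l~a ]
                         [ neighbour-of-childless no-child l~b ]

  childless-lineage-maximal : ∀ {l} → Childless l → IsMaximalClique G (_≼ l)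
  childless-lineage-maximal {l} no-child = lineage-clique l , maximal
    where
    maximal : ∀ w → IsClique G (λ x → x ≼ l ⊎ x ≡ w) → w ≼ l
    maximal w clique+w with w ≟ l
    ... | yes refl = refl
    ... | no  w≢l  =
      [ neighbour-of-childless no-child
          (clique+w l w (inj₁ refl) (inj₂ refl) (λ l≡w → w≢l (sym l≡w))) ]

module RootLeafPath {n r} (T : RootedTree n r) {m} (v : Fin (suc m) → Fin n)
                    (path : IsRootLeafPath T m v) where

  open Ancestry (parent T)

  v0≡r : v zero ≡ r
  v0≡r = proj₁ path

  v-parent : ∀ i → parent T (v (suc i)) ≡ just (v (inject₁ i))
  v-parent = proj₁ (proj₂ path)

  ℓ : Fin n
  ℓ = v (fromℕ m)

  ℓ-childless : Childless ℓ
  ℓ-childless = proj₂ (proj₂ path)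

  path⊆lineage : PathSet v ⊆ (_≼ ℓ)
  path⊆lineage (i , refl) =
    chain-reaches-last {R = _≼_} refl ≼-trans v (λ i → [ par (v-parent i) ]) i

  ancestors-on-path : ∀ {a x} → Anc (parent T) a x → ∀ j → v j ≡ x → PathSet v a
  ancestors-on-path a<x zero refl =
    contradiction (subst (Anc _ _) v0≡r a<x) (parentless⇒¬Anc (root-noPar T))
  ancestors-on-path (par p) (suc j) refl =
    inject₁ j , just-injective (trans (sym (v-parent j)) p)
  ancestors-on-path (step a<w p) (suc j) refl =
    ancestors-on-path a<w (inject₁ j) (just-injective (trans (sym (v-parent j)) p))

  lineage⊆path : (_≼ ℓ) ⊆ PathSet v
  lineage⊆path refl    = fromℕ m , refl
  lineage⊆path [ a<ℓ ] = ancestors-on-path a<ℓ (fromℕ m) refl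

lemma5 : ∀ {n : ℕ} (G : Graph n) (r : Fin n) (T : RootedTree n r) →
    IsTreeRep G T →
    (m : ℕ) (v : Fin (suc m) → Fin n) → IsRootLeafPath T m v →
    IsMaximalClique G (PathSet v) ×
    (∃ λ (k : ℕ) → 2 ≤ k × k ≤ 2 ⊔ suc m ×
    (∀ (i : Fin (suc m)) → k ≤ suc (toℕ i) →
    Simplicial G (v i) × PathSet v (v i)))
lemma5 G r T rep m v path =
  IsMaximalClique-resp G path⊆lineage lineage⊆path (childless-lineage-maximal ℓ-childless) ,
  (2 ⊔ suc m , m≤m⊔n 2 (suc m) , ≤-refl , leaf-simplicial)
  where
  open TreeRepresentation G T rep
  open RootLeafPath T v path

  -- With k = p + 1 (or 2) only the leaf v_p is required to be simplicial.
  leaf-simplicial : ∀ i → 2 ⊔ suc m ≤ suc (toℕ i) → Simplicial G (v i) × PathSet v (v i)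
  leaf-simplicial i k≤i+1 with last-index i (s≤s⁻¹ (≤-trans (m≤n⊔m 2 (suc m)) k≤i+1))
  ... | refl = childless-simplicial ℓ-childless , (i , refl)
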